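{- Let $I(n,p,q)$ be a connected $I$-graph, let $F$ be its $1$-factor consisting of the spokes, and let $Q(n,p,q)=I(n,p,q)/F$. Then $I(n,p,q)$ is Hamiltonian if and only if $Q(n,p,q)$ contains a good Eulerian subgraph.
   Context: For integers $n\ge 3$, $1\le p,q\le n-1$, $p,q\ne n/2$, $I(n,p,q)$ has vertices $v_i,u_i$ ($0\le i\le n-1$) and edges $[v_i,v_{i+p}]$ (outer edges), $[v_i,u_i]$ (spokes), $[u_i,u_{i+q}]$ (inner edges), subscripts modulo $n$. For a cubic graph $G$ with $1$-factor $F$ and $Y=G-F$, $G/F$ is obtained by contracting each $e=uv\in F$ to a vertex $x_e$; its edges are those of $Y$, and the four edge-ends at $x_e$ correspond to the edge-ends of $Y$ at $u$ and $v$. A transition at $x_e$ (unordered pair of distinct edge-ends) is non-traversing if both ends come from the same end of $e$, traversing otherwise. For a spanning subgraph $W$ of $G/F$ with all degrees $2$ or $4$: $W$ is admissible if the transition at each degree-$2$ vertex of $W$ is traversing; a good Eulerian tour is a closed walk using each edge of $W$ exactly once and using only non-traversing transitions when passing through degree-$4$ vertices of $W$; $W$ is a good Eulerian subgraph if it is admissible and has a good Eulerian tour. -}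

module Defs where

open import Data.Nat using (ℕ; zero; suc; _+_; _%_)
open import Data.Nat.DivMod using (m%n<n)
open import Data.Fin using (Fin; toℕ; fromℕ<)
open import Data.Fin.Properties using (_≟_)
open import Data.Bool using (Bool; true; false; if_then_else_; _∧_)
open import Data.Product using (Σ; ∃; _×_; _,_; proj₁; proj₂)
open import Data.Sum using (_⊎_)
open import Data.List using (List; []; _∷_; map; tabulate; cartesianProduct)
open import Data.Nat.ListAction using (sum)
open import Relation.Binary.PropositionalEquality using (_≡_; _≢_)
open import Relation.Nullary.Decidable using (⌊_⌋)
open import Relation.Binary.Construct.Closure.ReflexiveTransitive using (Star)
open import Function using (_∘_)
open import Function.Definitions using (Injective)

addMod : ∀ {n} → Fin n → ℕ → Fin n
addMod {suc m} i k = fromℕ< (m%n<n (toℕ i + k) (suc m))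

-- outer = the v-vertices / outer edges, inner = the u-vertices / inner edges
data Side : Set where
  outer inner : Side

step : ℕ → ℕ → Side → ℕ
step p q outer = p
step p q inner = q

-- (outer , i) is v_i ; (inner , i) is u_i
Vertex : ℕ → Set
Vertex n = Side × Fin n

data Adj (n p q : ℕ) : Vertex n → Vertex n → Set where
  spoke  : ∀ i → Adj n p q (outer , i) (inner , i)
  spoke' : ∀ i → Adj n p q (inner , i) (outer , i)
  outer⁺ : ∀ i → Adj n p q (outer , i) (outer , addMod i p)
  outer⁻ : ∀ i → Adj n p q (outer , addMod i p) (outer , i)
  inner⁺ : ∀ i → Adj n p q (inner , i) (inner , addMod i q)
  inner⁻ : ∀ i → Adj n p q (inner , addMod i q) (inner , i)

Connected : ℕ → ℕ → ℕ → Set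
Connected n p q = ∀ (a b : Vertex n) → Star (Adj n p q) a b

-- a Hamiltonian cycle: a cyclic ordering c 0, ..., c (2n-1) of all 2n
-- vertices (c injective on Fin (n + n), hence bijective) with consecutive
-- vertices (cyclically) adjacent
Hamiltonian : ℕ → ℕ → ℕ → Set
Hamiltonian n p q =
  Σ (Fin (n + n) → Vertex n) λ c →
    Injective _≡_ _≡_ c × (∀ k → Adj n p q (c k) (c (addMod k 1)))

-- Vertex x_i (i : Fin n) is the contracted spoke [v_i,u_i].
-- Edges of Q are the edges of Y = I(n,p,q) - F:
--   (outer , i) is the outer edge [v_i , v_{i+p}],
--   (inner , i) is the inner edge [u_i , u_{i+q}].
-- (These are pairwise distinct since 2p, 2q ≢ 0 mod n.)

QEdge : ℕ → Set
QEdge n = Side × Fin n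

data Pos : Set where
  tail head : Pos

-- edge-ends: (e , tail) is the end of e at v_i (resp. u_i),
--            (e , head) is the end at v_{i+p} (resp. u_{i+q})
End : ℕ → Set
End n = QEdge n × Pos

edgeOf : ∀ {n} → End n → QEdge n
edgeOf = proj₁

endG : ∀ {n} → ℕ → ℕ → End n → Vertex n
endG p q ((s , i) , tail) = s , i
endG p q ((s , i) , head) = s , addMod i (step p q s)

-- the vertex x_j of Q at which an edge-end lies (the spoke containing endG)
endQ : ∀ {n} → ℕ → ℕ → End n → Fin n
endQ p q ε = proj₂ (endG p q ε)

-- which end of the spoke the edge-end comes from (v-end or u-end)
spokeSide : ∀ {n} → End n → Side
spokeSide ((s , i) , _) = s

NonTraversing : ∀ {n} → End n → End n → Set
NonTraversing ε₁ ε₂ = spokeSide ε₁ ≡ spokeSide ε₂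

Traversing : ∀ {n} → End n → End n → Set
Traversing ε₁ ε₂ = spokeSide ε₁ ≢ spokeSide ε₂

allSides : List Side
allSides = outer ∷ inner ∷ []

allPos : List Pos
allPos = tail ∷ head ∷ []

allEnds : ∀ n → List (End n)
allEnds n = cartesianProduct (cartesianProduct allSides (tabulate (λ i → i))) allPos

-- spanning subgraphs W of Q, given by their edge sets

SubQ : ℕ → Set
SubQ n = QEdge n → Bool

InW : ∀ {n} → SubQ n → End n → Set
InW W ε = W (edgeOf ε) ≡ true

deg : ∀ {n} → ℕ → ℕ → SubQ n → Fin n → ℕ
deg {n} p q W j =
  sum (map (λ ε → if W (edgeOf ε) ∧ ⌊ endQ p q ε ≟ j ⌋ then 1 else 0) (allEnds n))

Degrees24 : ∀ {n} → ℕ → ℕ → SubQ n → Set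
Degrees24 p q W = ∀ j → deg p q W j ≡ 2 ⊎ deg p q W j ≡ 4

Admissible : ∀ {n} → ℕ → ℕ → SubQ n → Set
Admissible p q W =
  ∀ j → deg p q W j ≡ 2 →
  ∀ ε₁ ε₂ → InW W ε₁ → InW W ε₂ → endQ p q ε₁ ≡ j → endQ p q ε₂ ≡ j →
  ε₁ ≢ ε₂ → Traversing ε₁ ε₂

-- a traversal of an edge: true = from the tail end to the head end
Traversal : ℕ → Set
Traversal n = QEdge n × Bool

departEnd : ∀ {n} → Traversal n → End n
departEnd (e , true)  = e , tail
departEnd (e , false) = e , head

arriveEnd : ∀ {n} → Traversal n → End n
arriveEnd (e , true)  = e , head
arriveEnd (e , false) = e , tail

-- a good Eulerian tour of W: a closed walk w 0, w 1, ..., w (m-1) (cyclic)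
-- using every edge of W exactly once (and no other edges), such that at
-- each passage through a degree-4 vertex of W the transition (arrival
-- end of w k, departure end of w (k+1)) is non-traversing
GoodEulerianTour : ∀ {n} → ℕ → ℕ → SubQ n → Set
GoodEulerianTour {n} p q W =
  Σ ℕ λ m → Σ (Fin m → Traversal n) λ w →
    Injective _≡_ _≡_ (proj₁ ∘ w) ×
    (∀ k → W (proj₁ (w k)) ≡ true) ×
    (∀ e → W e ≡ true → ∃ λ k → proj₁ (w k) ≡ e) ×
    (∀ k → endQ p q (arriveEnd (w k)) ≡ endQ p q (departEnd (w (addMod k 1)))) ×
    (∀ k → deg p q W (endQ p q (arriveEnd (w k))) ≡ 4 →
           NonTraversing (arriveEnd (w k)) (departEnd (w (addMod k 1))))

GoodEulerianSubgraph : ∀ {n} → ℕ → ℕ → SubQ n → Set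
GoodEulerianSubgraph p q W =
  Degrees24 p q W × Admissible p q W × GoodEulerianTour p q W

module Submission where

-- (⇒) Let W be the set of Y-edges used by a Hamiltonian cycle C.  At a vertex
-- of I, C uses two of its three edges; so x_j has degree 2 in W when C uses the
-- spoke j (one W-end on each side: admissible) and degree 4 otherwise.
-- Contracting the spokes of C gives a good Eulerian tour of W.
-- (⇐) Follow a good Eulerian tour of W in I, crossing the spoke of x_j exactly
-- at the traversing transitions.  Degrees and admissibility show that this
-- closed walk meets every vertex, and at most once, so it is Hamiltonian.

open import Defs
open import Data.Nat using (ℕ; _+_; _≤_; _<_)
open import Data.Product using (∃)
open import Relation.Binary.PropositionalEquality using (_≢_)
open import Function.Bundles using (_⇔_)

open import Data.Nat using (zero; suc; _*_; _∸_; _%_; _/_; z≤n; s≤s)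
open import Data.Nat.Properties
open import Data.Nat.DivMod
open import Data.Nat.ListAction using (sum)
open import Data.Nat.ListAction.Properties using (sum-++)
open import Algebra.Properties.CommutativeSemigroup +-commutativeSemigroup using (interchange)
open import Data.Fin using (Fin; toℕ; fromℕ; inject₁; lower₁) renaming (zero to fz; suc to fs)
open import Data.Fin.Properties
  using (toℕ-fromℕ<; toℕ-injective; toℕ-inject₁; toℕ-fromℕ; toℕ<n; inject₁-lower₁; any?)
  renaming (_≟_ to _≟F_)
open import Data.Bool using (Bool; true; false; if_then_else_; _∧_)
open import Data.List using (List; []; _∷_; _++_; [_]; _∷ʳ_; length; map; tabulate; lookup; filter; allFin; cartesianProduct)
open import Data.List.Properties using (length-++; length-map; length-tabulate; map-++; map-∘; map-cong)
open import Data.List.Relation.Unary.Any using (here; there)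
import Data.List.Relation.Unary.Any as Any
open import Data.List.Relation.Unary.Any.Properties using (lookup-index)
import Data.List.Relation.Unary.All as All
open import Data.List.Relation.Unary.AllPairs using ([]; _∷_)
open import Data.List.Relation.Unary.Unique.Propositional using (Unique)
open import Data.List.Relation.Unary.Unique.Propositional.Properties
  using (tabulate⁺; filter⁺; ++⁺; allFin⁺; cartesianProduct⁺)
open import Data.List.Membership.Propositional using (_∈_)
open import Data.List.Membership.Propositional.Properties
  using (∈-∃++; ∈-++⁻; ∈-++⁺ˡ; ∈-++⁺ʳ; ∈-map⁺; ∈-map⁻; ∈-lookup; ∈-tabulate⁺; ∈-tabulate⁻;
         ∈-filter⁺; ∈-filter⁻; ∈-allFin; ∈-cartesianProduct⁺)
open import Data.Product using (Σ; ∃₂; _×_; _,_; proj₁; proj₂)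
open import Data.Product.Properties using (≡-dec)
open import Data.Sum using (_⊎_; inj₁; inj₂; [_,_]′)
open import Data.Empty using (⊥; ⊥-elim)
open import Data.Unit using (⊤; tt)
open import Relation.Nullary using (¬_; Dec; yes; no)
open import Relation.Nullary.Decidable using (⌊_⌋)
open import Relation.Unary using (Decidable)
open import Relation.Binary.PropositionalEquality hiding ([_])
open import Function.Bundles using (mk⇔)
open import Function.Definitions using (Injective)

toℕ-addMod : ∀ {m} (i : Fin (suc m)) k → toℕ (addMod i k) ≡ (toℕ i + k) % suc m
toℕ-addMod i k = toℕ-fromℕ< _

addMod-assoc : ∀ {n} (i : Fin n) a b → addMod (addMod i a) b ≡ addMod i (a + b)
addMod-assoc {suc m} i a b = toℕ-injective (begin
  toℕ (addMod (addMod i a) b)           ≡⟨ toℕ-addMod (addMod i a) b ⟩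
  (toℕ (addMod i a) + b) % suc m        ≡⟨ cong (λ z → (z + b) % suc m) (toℕ-addMod i a) ⟩
  ((toℕ i + a) % suc m + b) % suc m     ≡⟨ %-distribˡ-+ ((toℕ i + a) % suc m) b (suc m) ⟩
  ((toℕ i + a) % suc m % suc m + b % suc m) % suc m
    ≡⟨ cong (λ z → (z + b % suc m) % suc m) (m%n%n≡m%n (toℕ i + a) (suc m)) ⟩
  ((toℕ i + a) % suc m + b % suc m) % suc m ≡⟨ %-distribˡ-+ (toℕ i + a) b (suc m) ⟨
  (toℕ i + a + b) % suc m               ≡⟨ cong (_% suc m) (+-assoc (toℕ i) a b) ⟩
  (toℕ i + (a + b)) % suc m             ≡⟨ toℕ-addMod i (a + b) ⟨
  toℕ (addMod i (a + b))                ∎)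
  where open ≡-Reasoning

addMod-multiple : ∀ {n} (i : Fin n) k → addMod i (k * n) ≡ i
addMod-multiple {suc m} i k = toℕ-injective (begin
  toℕ (addMod i (k * suc m))   ≡⟨ toℕ-addMod i (k * suc m) ⟩
  (toℕ i + k * suc m) % suc m  ≡⟨ [m+kn]%n≡m%n (toℕ i) k (suc m) ⟩
  toℕ i % suc m                ≡⟨ m<n⇒m%n≡m (toℕ<n i) ⟩
  toℕ i                        ∎)
  where open ≡-Reasoning

addMod-n : ∀ {n} (i : Fin n) → addMod i n ≡ i
addMod-n {n} i = trans (cong (addMod i) (sym (+-identityʳ n))) (addMod-multiple i 1)

-- a shift is injective: shifting a further (n − 1)·a times undoes it
addMod-injective : ∀ {n} a {i j : Fin n} → addMod i a ≡ addMod j a → i ≡ j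
addMod-injective {suc m} a {i} {j} eq = begin
  i                              ≡⟨ addMod-multiple i a ⟨
  addMod i (a * suc m)           ≡⟨ cong (addMod i) (*-comm a (suc m)) ⟩
  addMod i (a + m * a)           ≡⟨ addMod-assoc i a (m * a) ⟨
  addMod (addMod i a) (m * a)    ≡⟨ cong (λ z → addMod z (m * a)) eq ⟩
  addMod (addMod j a) (m * a)    ≡⟨ addMod-assoc j a (m * a) ⟩
  addMod j (a + m * a)           ≡⟨ cong (addMod j) (*-comm (suc m) a) ⟩
  addMod j (a * suc m)           ≡⟨ addMod-multiple j a ⟩
  j                              ∎
  where open ≡-Reasoning

addMod-fixedPointFree : ∀ {n} (j : Fin n) s → 0 < s → s < n → addMod j s ≢ j
addMod-fixedPointFree {suc m} j s 0<s s<n eq = contradiction-by-size ((toℕ j + s) / suc m) s≡qn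
  where
  x = toℕ j
  x+s≡x+qn : x + s ≡ x + ((x + s) / suc m) * suc m
  x+s≡x+qn = trans (m≡m%n+[m/n]*n (x + s) (suc m))
    (cong (_+ ((x + s) / suc m) * suc m) (trans (sym (toℕ-addMod j s)) (cong toℕ eq)))
  s≡qn : s ≡ ((x + s) / suc m) * suc m
  s≡qn = +-cancelˡ-≡ x s _ x+s≡x+qn
  contradiction-by-size : ∀ k → s ≡ k * suc m → ⊥
  contradiction-by-size zero e = <-irrefl (sym e) 0<s
  contradiction-by-size (suc k) e =
    <-irrefl refl (<-≤-trans s<n (subst (suc m ≤_) (sym e) (m≤m+n (suc m) (k * suc m))))

-- j − s (mod n), for s ≤ n; 'back j s' is the unique i with i + s ≡ j
back : ∀ {n} → Fin n → ℕ → Fin n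
back {n} j s = addMod j (n ∸ s)

addMod-back : ∀ {n} (j : Fin n) s → s ≤ n → addMod (back j s) s ≡ j
addMod-back {n} j s s≤n = trans (addMod-assoc j (n ∸ s) s) (trans (cong (addMod j) (m∸n+n≡m s≤n)) (addMod-n j))

back-unique : ∀ {n} {i j : Fin n} s → s ≤ n → addMod i s ≡ j → i ≡ back j s
back-unique s s≤n eq = addMod-injective s (trans eq (sym (addMod-back _ s s≤n)))

next : ∀ {N} → Fin N → Fin N
next k = addMod k 1

prev : ∀ {N} → Fin N → Fin N
prev k = back k 1

next-prev : ∀ {N} (k : Fin N) → next (prev k) ≡ k
next-prev {suc _} k = addMod-back k 1 (s≤s z≤n)

prev-unique : ∀ {N} {i k : Fin N} → next i ≡ k → i ≡ prev k
prev-unique {suc _} = back-unique 1 (s≤s z≤n)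

next-injective : ∀ {N} {i j : Fin N} → next i ≡ next j → i ≡ j
next-injective = addMod-injective 1

next-fixedPointFree : ∀ {N} → 1 < N → (k : Fin N) → next k ≢ k
next-fixedPointFree 1<N k = addMod-fixedPointFree k 1 (s≤s z≤n) 1<N

next²-fixedPointFree : ∀ {N} → 2 < N → (k : Fin N) → next (next k) ≢ k
next²-fixedPointFree 2<N k eq = addMod-fixedPointFree k 2 (s≤s z≤n) 2<N (trans (sym (addMod-assoc k 1 1)) eq)

next-inject₁ : ∀ {M} (k : Fin M) → next (inject₁ k) ≡ fs k
next-inject₁ {M} k = toℕ-injective (begin
  toℕ (next (inject₁ k))        ≡⟨ toℕ-addMod (inject₁ k) 1 ⟩
  (toℕ (inject₁ k) + 1) % suc M ≡⟨ cong (λ z → (z + 1) % suc M) (toℕ-inject₁ k) ⟩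
  (toℕ k + 1) % suc M           ≡⟨ m<n⇒m%n≡m (subst (_< suc M) (+-comm 1 (toℕ k)) (s≤s (toℕ<n k))) ⟩
  toℕ k + 1                     ≡⟨ +-comm (toℕ k) 1 ⟩
  toℕ (fs k)                    ∎)
  where open ≡-Reasoning

next-fromℕ : ∀ M → next (fromℕ M) ≡ fz
next-fromℕ M = toℕ-injective (begin
  toℕ (next (fromℕ M))        ≡⟨ toℕ-addMod (fromℕ M) 1 ⟩
  (toℕ (fromℕ M) + 1) % suc M ≡⟨ cong (λ z → (z + 1) % suc M) (toℕ-fromℕ M) ⟩
  (M + 1) % suc M             ≡⟨ cong (_% suc M) (+-comm M 1) ⟩
  suc M % suc M               ≡⟨ n%n≡0 (suc M) ⟩
  0                           ∎)
  where open ≡-Reasoning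

ind : Bool → ℕ
ind b = if b then 1 else 0

ind≤1 : ∀ b → ind b ≤ 1
ind≤1 true  = s≤s z≤n
ind≤1 false = z≤n

count : ∀ {A : Set} → (A → Bool) → List A → ℕ
count b xs = sum (map (λ x → ind (b x)) xs)

module _ {A : Set} (b : A → Bool) where

  count-none : ∀ xs → (∀ {x} → x ∈ xs → b x ≡ false) → count b xs ≡ 0
  count-none []       none = refl
  count-none (x ∷ xs) none rewrite none (here refl) = count-none xs (λ m → none (there m))

  count-one : ∀ xs {u} → Unique xs → u ∈ xs → b u ≡ true →
              (∀ {x} → x ∈ xs → b x ≡ true → x ≡ u) → count b xs ≡ 1
  count-one (x ∷ xs) (x∉xs ∷ _) (here refl) bu only rewrite bu =
    cong suc (count-none xs passes-not)
    where
    passes-not : ∀ {y} → y ∈ xs → b y ≡ false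
    passes-not {y} m with b y in by
    ... | false = refl
    ... | true  = ⊥-elim (All.lookup x∉xs m (sym (only (there m) by)))
  count-one (x ∷ xs) (x∉xs ∷ u) (there m) bu only with b x in bx
  ... | true  = ⊥-elim (All.lookup x∉xs (subst (_∈ xs) (sym (only (here refl) bx)) m) refl)
  ... | false = count-one xs u m bu (λ m' → only (there m'))

  count-two : ∀ xs {u v} → Unique xs → u ∈ xs → v ∈ xs → u ≢ v → b u ≡ true → b v ≡ true →
              (∀ {x} → x ∈ xs → b x ≡ true → x ≡ u ⊎ x ≡ v) → count b xs ≡ 2
  count-two (x ∷ xs) (x∉xs ∷ un) (here refl) (here refl) u≢v _ _ _ = ⊥-elim (u≢v refl)
  count-two (x ∷ xs) (x∉xs ∷ un) (here refl) (there mv) u≢v bu bv only rewrite bu =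
    cong suc (count-one xs un mv bv (λ m bx → other (only (there m) bx) m))
    where
    other : ∀ {y} → y ≡ x ⊎ y ≡ _ → y ∈ xs → y ≡ _
    other (inj₁ refl) m = ⊥-elim (All.lookup x∉xs m refl)
    other (inj₂ e)    _ = e
  count-two (x ∷ xs) (x∉xs ∷ un) (there mu) (here refl) u≢v bu bv only rewrite bv =
    cong suc (count-one xs un mu bu (λ m bx → other (only (there m) bx) m))
    where
    other : ∀ {y} → y ≡ _ ⊎ y ≡ x → y ∈ xs → y ≡ _
    other (inj₁ e)    _ = e
    other (inj₂ refl) m = ⊥-elim (All.lookup x∉xs m refl)
  count-two (x ∷ xs) (x∉xs ∷ un) (there mu) (there mv) u≢v bu bv only with b x in bx
  ... | true  = ⊥-elim (x∉ (only (here refl) bx))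
    where
    x∉ : ¬ (x ≡ _ ⊎ x ≡ _)
    x∉ (inj₁ refl) = All.lookup x∉xs mu refl
    x∉ (inj₂ refl) = All.lookup x∉xs mv refl
  ... | false = count-two xs un mu mv u≢v bu bv (λ m → only (there m))

count-∧-at : ∀ {A : Set} (b t : A → Bool) xs {x} → Unique xs → x ∈ xs → t x ≡ true →
             (∀ {y} → y ∈ xs → t y ≡ true → y ≡ x) → count (λ y → b y ∧ t y) xs ≡ ind (b x)
count-∧-at b t xs {x} u mx tx only with b x in bx
... | true  = count-one (λ y → b y ∧ t y) xs u mx (subst (λ z → z ∧ t x ≡ true) (sym bx) tx)
                (λ m e → only m (∧-true₂ e))
  where
  ∧-true₂ : ∀ {c d} → c ∧ d ≡ true → d ≡ true
  ∧-true₂ {true} e = e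
... | false = count-none (λ y → b y ∧ t y) xs fails
  where
  fails : ∀ {y} → y ∈ xs → b y ∧ t y ≡ false
  fails {y} m with b y in by | t y in ty
  ... | false | _     = refl
  ... | true  | false = refl
  ... | true  | true  = ⊥-elim (true≢false (trans (sym by) (trans (cong b (only m ty)) bx)))
    where
    true≢false : true ≢ false
    true≢false ()

-- Walks.  'Chain R a xs b' says that the sequence a, xs, b has R between
-- any two consecutive entries; a closed walk is a 'Chain R a xs a'.

module _ {A : Set} where

  data Chain (R : A → A → Set) : A → List A → A → Set where
    done : ∀ {a b} → R a b → Chain R a [] b
    link : ∀ {a x xs b} → R a x → Chain R x xs b → Chain R a (x ∷ xs) b

  data Consec : A → List A → A → A → A → Set where
    last  : ∀ {a b} → Consec a [] b a b
    first : ∀ {a x xs b} → Consec a (x ∷ xs) b a x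
    later : ∀ {a x xs b t t'} → Consec x xs b t t' → Consec a (x ∷ xs) b t t'

  chain-consec : ∀ {R a xs b t t'} → Chain R a xs b → Consec a xs b t t' → R t t'
  chain-consec (done r)   last      = r
  chain-consec (link r _) first     = r
  chain-consec (link _ c) (later k) = chain-consec c k

  consec-fst : ∀ {a xs b t t'} → Consec a xs b t t' → t ∈ a ∷ xs
  consec-fst last      = here refl
  consec-fst first     = here refl
  consec-fst (later k) = there (consec-fst k)

  consec-snd : ∀ {a xs b t t'} → Consec a xs b t t' → t' ∈ xs ∷ʳ b
  consec-snd last      = here refl
  consec-snd first     = here refl
  consec-snd (later k) = there (consec-snd k)

  consec-succ : ∀ {a xs b t} → t ∈ a ∷ xs → ∃ λ t' → Consec a xs b t t'
  consec-succ {xs = []}     (here refl) = _ , last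
  consec-succ {xs = x ∷ xs} (here refl) = _ , first
  consec-succ {xs = x ∷ xs} (there m)   with t' , k ← consec-succ m = t' , later k

  consec-pred : ∀ {a xs b t'} → t' ∈ xs ∷ʳ b → ∃ λ t → Consec a xs b t t'
  consec-pred {xs = []}     (here refl) = _ , last
  consec-pred {xs = x ∷ xs} (here refl) = _ , first
  consec-pred {xs = x ∷ xs} (there m)   with t , k ← consec-pred m = t , later k

  cyclic-pred : ∀ {a xs t'} → t' ∈ a ∷ xs → ∃ λ t → Consec a xs a t t'
  cyclic-pred {a} {xs} (here refl) = consec-pred (∈-++⁺ʳ xs (here refl))
  cyclic-pred {a} {xs} (there m)   = consec-pred (∈-++⁺ˡ m)

  ∈-∷ʳ⇒∈-∷ : ∀ {y a} (xs : List A) → y ∈ xs ∷ʳ a → y ∈ a ∷ xs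
  ∈-∷ʳ⇒∈-∷ xs m with ∈-++⁻ xs m
  ... | inj₁ m'          = there m'
  ... | inj₂ (here refl) = here refl

  chain-++ : ∀ {R a} xs {y} ys {b} → Chain R a xs y → Chain R y ys b → Chain R a (xs ++ y ∷ ys) b
  chain-++ []       ys (done r)   c' = link r c'
  chain-++ (x ∷ xs) ys (link r c) c' = link r (chain-++ xs ys c c')

  -- Dropping the entries that fail P from a walk in which no two consecutive
  -- entries fail P leaves a walk whose steps are single steps or double steps
  -- over a dropped entry.
  Hop : (A → A → Set) → (A → Set) → A → A → Set
  Hop L P u v = P u × P v × (L u v ⊎ ∃ λ x → L u x × ¬ P x × L x v)

  chain-filter : ∀ {P : A → Set} (P? : Decidable P) {L : A → A → Set} →
    (∀ {x y} → L x y → ¬ P x → ¬ P y → ⊥) →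
    ∀ {a} xs {b} → P a → P b → Chain L a xs b → Chain (Hop L P) a (filter P? xs) b
  chain-filter P? noTwo []       pa pb (done l) = done (pa , pb , inj₁ l)
  chain-filter P? noTwo (x ∷ xs) pa pb (link l c) with P? x
  ... | yes px = link (pa , px , inj₁ l) (chain-filter P? noTwo xs px pb c)
  chain-filter P? noTwo (x ∷ []) pa pb (link l (done l')) | no ¬px =
    done (pa , pb , inj₂ (x , l , ¬px , l'))
  chain-filter P? noTwo (x ∷ y ∷ xs) pa pb (link l (link l' c)) | no ¬px with P? y
  ... | yes py  = link (pa , py , inj₂ (x , l , ¬px , l')) (chain-filter P? noTwo xs py pb c)
  ... | no ¬py  = ⊥-elim (noTwo l' ¬px ¬py)

  closedChain : ∀ {R : A → A → Set} {M} (f : Fin (suc M) → A) → (∀ k → R (f k) (f (next k))) →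
                Chain R (f fz) (tabulate (λ k → f (fs k))) (f fz)
  closedChain {R} {M} f cyc = go f stepWithin wrapAround
    where
    stepWithin : ∀ k → R (f (inject₁ k)) (f (fs k))
    stepWithin k = subst (λ i → R (f (inject₁ k)) (f i)) (next-inject₁ k) (cyc (inject₁ k))
    wrapAround : R (f (fromℕ M)) (f fz)
    wrapAround = subst (λ i → R (f (fromℕ M)) (f i)) (next-fromℕ M) (cyc (fromℕ M))
    go : ∀ {K} (g : Fin (suc K) → A) → (∀ k → R (g (inject₁ k)) (g (fs k))) →
         R (g (fromℕ K)) (f fz) → Chain R (g fz) (tabulate (λ k → g (fs k))) (f fz)
    go {zero}  g within around = done around
    go {suc K} g within around = link (within fz) (go (λ k → g (fs k)) (λ k → within (fs k)) around)

  cyclicLookup : ∀ {R a xs} → Chain R a xs a → ∀ k → R (lookup (a ∷ xs) k) (lookup (a ∷ xs) (next k))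
  cyclicLookup {R} {a} {xs} c k with length xs Data.Nat.≟ toℕ k
  ... | yes len≡k = subst (λ i → R (at i) (at (next i))) lastIdx
                      (subst (λ i → R (at (fromℕ (length xs))) (at i)) (sym (next-fromℕ (length xs))) (atLast c))
    where
    at = lookup (a ∷ xs)
    lastIdx : fromℕ (length xs) ≡ k
    lastIdx = toℕ-injective (trans (toℕ-fromℕ (length xs)) len≡k)
    atLast : ∀ {b ys} → Chain R b ys a → R (lookup (b ∷ ys) (fromℕ (length ys))) a
    atLast (done r)   = r
    atLast (link _ c) = atLast c
  ... | no len≢k = subst (λ i → R (at i) (at (next i))) (inject₁-lower₁ k len≢k)
                     (subst (λ i → R (at (inject₁ k')) (at i)) (sym (next-inject₁ k')) (atInner c k'))
    where
    at = lookup (a ∷ xs)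
    k' = lower₁ k len≢k
    atInner : ∀ {b ys c} → Chain R b ys c → (i : Fin (length ys)) →
              R (lookup (b ∷ ys) (inject₁ i)) (lookup (b ∷ ys) (fs i))
    atInner (link r _) fz     = r
    atInner (link _ c) (fs i) = atInner c i

chain-map : ∀ {A B : Set} {R : A → A → Set} {S : B → B → Set} (f : A → B) {a xs b} →
            (∀ {x y} → R x y → S (f x) (f y)) → Chain R a xs b → Chain S (f a) (map f xs) (f b)
chain-map f hom (done r)   = done (hom r)
chain-map f hom (link r c) = link (hom r) (chain-map f hom c)

module _ {A : Set} where

  unique-map-injectiveOn : ∀ {B : Set} (f : A → B) {xs : List A} → Unique xs →
    (∀ {x y} → x ∈ xs → y ∈ xs → f x ≡ f y → x ≡ y) → Unique (map f xs)
  unique-map-injectiveOn f []              inj = []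
  unique-map-injectiveOn f {x ∷ xs} (x∉ ∷ u) inj =
    All.tabulate differs ∷ unique-map-injectiveOn f u (λ m m' → inj (there m) (there m'))
    where
    differs : ∀ {z} → z ∈ map f xs → f x ≢ z
    differs m e with y , my , refl ← ∈-map⁻ f m = All.lookup x∉ my (inj (here refl) (there my) e)

  lookup-injective : ∀ (xs : List A) → Unique xs → ∀ {i j} → lookup xs i ≡ lookup xs j → i ≡ j
  lookup-injective (x ∷ xs) (x∉ ∷ u) {fz}   {fz}   e = refl
  lookup-injective (x ∷ xs) (x∉ ∷ u) {fz}   {fs j} e = ⊥-elim (All.lookup x∉ (∈-lookup j) e)
  lookup-injective (x ∷ xs) (x∉ ∷ u) {fs i} {fz}   e = ⊥-elim (All.lookup x∉ (∈-lookup i) (sym e))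
  lookup-injective (x ∷ xs) (x∉ ∷ u) {fs i} {fs j} e = cong fs (lookup-injective xs u e)

  private
    length-remove : ∀ (ys₁ : List A) x ys₂ → length (ys₁ ++ [ x ] ++ ys₂) ≡ suc (length (ys₁ ++ ys₂))
    length-remove ys₁ x ys₂ = begin
      length (ys₁ ++ x ∷ ys₂)          ≡⟨ length-++ ys₁ ⟩
      length ys₁ + suc (length ys₂)    ≡⟨ +-suc (length ys₁) (length ys₂) ⟩
      suc (length ys₁ + length ys₂)    ≡⟨ cong suc (length-++ ys₁) ⟨
      suc (length (ys₁ ++ ys₂))        ∎
      where open ≡-Reasoning

    ⊆-remove : ∀ {xs : List A} {x} ys₁ ys₂ → (∀ {z} → z ∈ xs → z ≢ x) →
               (∀ {z} → z ∈ xs → z ∈ ys₁ ++ [ x ] ++ ys₂) → ∀ {z} → z ∈ xs → z ∈ ys₁ ++ ys₂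
    ⊆-remove ys₁ ys₂ ≢x sub m with ∈-++⁻ ys₁ (sub m)
    ... | inj₁ m₁         = ∈-++⁺ˡ m₁
    ... | inj₂ (here e)   = ⊥-elim (≢x m e)
    ... | inj₂ (there m₂) = ∈-++⁺ʳ ys₁ m₂

  unique-⊆⇒length≤ : ∀ {xs ys : List A} → Unique xs → (∀ {z} → z ∈ xs → z ∈ ys) → length xs ≤ length ys
  unique-⊆⇒length≤ {[]}     u sub = z≤n
  unique-⊆⇒length≤ {x ∷ xs} (x∉ ∷ u) sub with ys₁ , ys₂ , refl ← ∈-∃++ (sub (here refl)) =
    subst (suc (length xs) ≤_) (sym (length-remove ys₁ x ys₂))
      (s≤s (unique-⊆⇒length≤ u (⊆-remove ys₁ ys₂ (λ m e → All.lookup x∉ m (sym e)) (λ m → sub (there m)))))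

  unique-⊆⇒complete : (∀ (x y : A) → Dec (x ≡ y)) → ∀ {xs ys : List A} → Unique xs →
    (∀ {z} → z ∈ xs → z ∈ ys) → length ys ≤ length xs → ∀ {y} → y ∈ ys → y ∈ xs
  unique-⊆⇒complete _≟_ {xs} u sub long {y} m with Any.any? (y ≟_) xs
  ... | yes m' = m'
  ... | no y∉ with ys₁ , ys₂ , refl ← ∈-∃++ m =
    ⊥-elim (<-irrefl refl (<-≤-trans (s≤s shorter) (subst (_≤ length xs) (length-remove ys₁ y ys₂) long)))
    where
    shorter : length xs ≤ length (ys₁ ++ ys₂)
    shorter = unique-⊆⇒length≤ u (⊆-remove ys₁ ys₂ (λ m e → y∉ (subst (_∈ xs) e m)) sub)

sum-map-+ : ∀ {A : Set} (f g : A → ℕ) (xs : List A) →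
            sum (map (λ x → f x + g x) xs) ≡ sum (map f xs) + sum (map g xs)
sum-map-+ f g []       = refl
sum-map-+ f g (x ∷ xs) = trans (cong (f x + g x +_) (sum-map-+ f g xs)) (interchange (f x) (g x) _ _)

sum-cartesianProduct : ∀ {A B : Set} (f : A × B → ℕ) xs ys →
  sum (map f (cartesianProduct xs ys)) ≡ sum (map (λ x → sum (map (λ y → f (x , y)) ys)) xs)
sum-cartesianProduct f []       ys = refl
sum-cartesianProduct f (x ∷ xs) ys = begin
  sum (map f (map (x ,_) ys ++ cartesianProduct xs ys))
    ≡⟨ cong sum (map-++ f (map (x ,_) ys) _) ⟩
  sum (map f (map (x ,_) ys) ++ map f (cartesianProduct xs ys))
    ≡⟨ sum-++ (map f (map (x ,_) ys)) _ ⟩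
  sum (map f (map (x ,_) ys)) + sum (map f (cartesianProduct xs ys))
    ≡⟨ cong₂ _+_ (cong sum (sym (map-∘ ys))) (sum-cartesianProduct f xs ys) ⟩
  sum (map (λ y → f (x , y)) ys) + sum (map (λ x → sum (map (λ y → f (x , y)) ys)) xs) ∎
  where open ≡-Reasoning

length-cartesianProduct : ∀ {A B : Set} (xs : List A) (ys : List B) →
  length (cartesianProduct xs ys) ≡ length xs * length ys
length-cartesianProduct []       ys = refl
length-cartesianProduct (x ∷ xs) ys = begin
  length (map (x ,_) ys ++ cartesianProduct xs ys)       ≡⟨ length-++ (map (x ,_) ys) ⟩
  length (map (x ,_) ys) + length (cartesianProduct xs ys)
    ≡⟨ cong₂ _+_ (length-map (x ,_) ys) (length-cartesianProduct xs ys) ⟩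
  length ys + length xs * length ys                     ∎
  where open ≡-Reasoning

_≟S_ : (a b : Side) → Dec (a ≡ b)
outer ≟S outer = yes refl
outer ≟S inner = no (λ ())
inner ≟S outer = no (λ ())
inner ≟S inner = yes refl

_≟P_ : (a b : Pos) → Dec (a ≡ b)
tail ≟P tail = yes refl
tail ≟P head = no (λ ())
head ≟P tail = no (λ ())
head ≟P head = yes refl

_≟V_ : ∀ {n} (a b : Vertex n) → Dec (a ≡ b)
_≟V_ = ≡-dec _≟S_ _≟F_

_≟E_ : ∀ {n} (a b : End n) → Dec (a ≡ b)
_≟E_ = ≡-dec (≡-dec _≟S_ _≟F_) _≟P_

allVertices : ∀ n → List (Vertex n)
allVertices n = cartesianProduct allSides (allFin n)

allVertices-unique : ∀ n → Unique (allVertices n)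
allVertices-unique n = cartesianProduct⁺ (((λ ()) All.∷ All.[]) ∷ (All.[] ∷ [])) (allFin⁺ n)

∈-allVertices : ∀ {n} (v : Vertex n) → v ∈ allVertices n
∈-allVertices {n} (s , j) = ∈-cartesianProduct⁺ {xs = allSides} {ys = allFin n} (side∈ s) (∈-allFin j)
  where
  side∈ : ∀ s → s ∈ allSides
  side∈ outer = here refl
  side∈ inner = there (here refl)

length-allVertices : ∀ n → length (allVertices n) ≡ n + n
length-allVertices n = begin
  length (allVertices n)            ≡⟨ length-cartesianProduct allSides (allFin n) ⟩
  2 * length (allFin n)             ≡⟨ cong (2 *_) (length-tabulate {n = n} (λ i → i)) ⟩
  n + (n + 0)                       ≡⟨ cong (n +_) (+-identityʳ n) ⟩
  n + n                             ∎
  where open ≡-Reasoning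

-- The edges of I(n,p,q): the edges of Y = I − F (indexed like the edges of Q)
-- and the spokes.
data IEdge (n : ℕ) : Set where
  yEdge  : QEdge n → IEdge n
  spokeE : Fin n → IEdge n

_≟I_ : ∀ {n} (g h : IEdge n) → Dec (g ≡ h)
yEdge e  ≟I yEdge e'  with ≡-dec _≟S_ _≟F_ e e'
... | yes refl = yes refl
... | no e≢e'  = no (λ { refl → e≢e' refl })
yEdge _  ≟I spokeE _  = no (λ ())
spokeE _ ≟I yEdge _   = no (λ ())
spokeE j ≟I spokeE j' with j ≟F j'
... | yes refl = yes refl
... | no j≢j'  = no (λ { refl → j≢j' refl })

yEdge-injective : ∀ {n} {e e' : QEdge n} → yEdge e ≡ yEdge e' → e ≡ e'
yEdge-injective refl = refl

IsY : ∀ {n} → IEdge n → Set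
IsY (yEdge _)  = ⊤
IsY (spokeE _) = ⊥

notY⇒spoke : ∀ {n} (g : IEdge n) → ¬ IsY g → ∃ λ j → g ≡ spokeE j
notY⇒spoke (yEdge _)  ¬y = ⊥-elim (¬y tt)
notY⇒spoke (spokeE j) _  = j , refl

departEnd-edge : ∀ {n} (t : Traversal n) → edgeOf (departEnd t) ≡ proj₁ t
departEnd-edge (e , true)  = refl
departEnd-edge (e , false) = refl

arriveEnd-edge : ∀ {n} (t : Traversal n) → edgeOf (arriveEnd t) ≡ proj₁ t
arriveEnd-edge (e , true)  = refl
arriveEnd-edge (e , false) = refl

arriveEnd≢departEnd : ∀ {n} (t : Traversal n) → arriveEnd t ≢ departEnd t
arriveEnd≢departEnd (e , true)  ()
arriveEnd≢departEnd (e , false) ()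

ends-of-traversal : ∀ {n} (t : Traversal n) (ε : End n) → proj₁ t ≡ edgeOf ε → ε ≡ departEnd t ⊎ ε ≡ arriveEnd t
ends-of-traversal (e , true)  (.e , tail) refl = inj₁ refl
ends-of-traversal (e , true)  (.e , head) refl = inj₂ refl
ends-of-traversal (e , false) (.e , tail) refl = inj₂ refl
ends-of-traversal (e , false) (.e , head) refl = inj₁ refl

endG-split : ∀ {n} p q (ε : End n) → endG p q ε ≡ (spokeSide ε , endQ p q ε)
endG-split p q (_ , tail) = refl
endG-split p q (_ , head) = refl

endG-≡ : ∀ {n} p q {ε₁ ε₂ : End n} → endG p q ε₁ ≡ endG p q ε₂ →
         spokeSide ε₁ ≡ spokeSide ε₂ × endQ p q ε₁ ≡ endQ p q ε₂
endG-≡ p q {ε₁} {ε₂} e = cong proj₁ split , cong proj₂ split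
  where
  split = trans (sym (endG-split p q ε₁)) (trans e (endG-split p q ε₂))

module Local (n' p q : ℕ) (0<p : 0 < p) (p<n : p < suc n') (0<q : 0 < q) (q<n : q < suc n') where

  n = suc n'

  st : Side → ℕ
  st = step p q

  st-pos : ∀ s → 0 < st s
  st-pos outer = 0<p
  st-pos inner = 0<q

  st<n : ∀ s → st s < n
  st<n outer = p<n
  st<n inner = q<n

  st≤n : ∀ s → st s ≤ n
  st≤n s = <⇒≤ (st<n s)

  edgeOfAdj : ∀ {a b} → Adj n p q a b → IEdge n
  edgeOfAdj (spoke i)  = spokeE i
  edgeOfAdj (spoke' i) = spokeE i
  edgeOfAdj (outer⁺ i) = yEdge (outer , i)
  edgeOfAdj (outer⁻ i) = yEdge (outer , i)
  edgeOfAdj (inner⁺ i) = yEdge (inner , i)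
  edgeOfAdj (inner⁻ i) = yEdge (inner , i)

  endpoints : IEdge n → Vertex n × Vertex n
  endpoints (yEdge e)  = endG p q (e , tail) , endG p q (e , head)
  endpoints (spokeE j) = (outer , j) , (inner , j)

  Joins : IEdge n → Vertex n → Vertex n → Set
  Joins g a b = endpoints g ≡ (a , b) ⊎ endpoints g ≡ (b , a)

  adj-joins : ∀ {a b} (x : Adj n p q a b) → Joins (edgeOfAdj x) a b
  adj-joins (spoke i)  = inj₁ refl
  adj-joins (spoke' i) = inj₂ refl
  adj-joins (outer⁺ i) = inj₁ refl
  adj-joins (outer⁻ i) = inj₂ refl
  adj-joins (inner⁺ i) = inj₁ refl
  adj-joins (inner⁻ i) = inj₂ refl

  joins-same : ∀ {g a b a' b'} → Joins g a b → Joins g a' b' → (a ≡ a' × b ≡ b') ⊎ (a ≡ b' × b ≡ a')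
  joins-same (inj₁ e) (inj₁ e') = inj₁ (cong proj₁ (trans (sym e) e') , cong proj₂ (trans (sym e) e'))
  joins-same (inj₁ e) (inj₂ e') = inj₂ (cong proj₁ (trans (sym e) e') , cong proj₂ (trans (sym e) e'))
  joins-same (inj₂ e) (inj₁ e') = inj₂ (cong proj₂ (trans (sym e) e') , cong proj₁ (trans (sym e) e'))
  joins-same (inj₂ e) (inj₂ e') = inj₁ (cong proj₂ (trans (sym e) e') , cong proj₁ (trans (sym e) e'))

  spoke-joins : ∀ {j a b} → Joins (spokeE j) a b → proj₂ a ≡ j × proj₂ b ≡ j
  spoke-joins (inj₁ refl) = refl , refl
  spoke-joins (inj₂ refl) = refl , refl

  IsEndpoint : IEdge n → Vertex n → Set
  IsEndpoint g v = proj₁ (endpoints g) ≡ v ⊎ proj₂ (endpoints g) ≡ v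

  edgesAt : Vertex n → List (IEdge n)
  edgesAt (s , j) = spokeE j ∷ yEdge (s , j) ∷ yEdge (s , back j (st s)) ∷ []

  edgesAt-unique : ∀ v → Unique (edgesAt v)
  edgesAt-unique (s , j) = ((λ ()) All.∷ (λ ()) All.∷ All.[]) ∷ (yy-distinct All.∷ All.[]) ∷ (All.[] ∷ [])
    where
    yy-distinct : yEdge (s , j) ≢ yEdge (s , back j (st s))
    yy-distinct e = addMod-fixedPointFree j (st s) (st-pos s) (st<n s)
                      (subst (λ k → addMod k (st s) ≡ j) (sym (cong index e)) (addMod-back j (st s) (st≤n s)))
      where
      index : IEdge n → Fin n
      index (yEdge (_ , i)) = i
      index (spokeE i)      = i

  edgesAt-endpoint : ∀ {g v} → g ∈ edgesAt v → IsEndpoint g v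
  edgesAt-endpoint {v = outer , j} (here refl)                 = inj₁ refl
  edgesAt-endpoint {v = inner , j} (here refl)                 = inj₂ refl
  edgesAt-endpoint                 (there (here refl))         = inj₁ refl
  edgesAt-endpoint {v = s , j}     (there (there (here refl))) = inj₂ (cong (s ,_) (addMod-back j (st s) (st≤n s)))

  endpoint-edgesAt : ∀ {g v} → IsEndpoint g v → g ∈ edgesAt v
  endpoint-edgesAt {yEdge (s , i)} (inj₁ refl) = there (here refl)
  endpoint-edgesAt {yEdge (s , i)} (inj₂ refl) =
    there (there (here (cong (λ k → yEdge (s , k)) (back-unique (st s) (st≤n s) refl))))
  endpoint-edgesAt {spokeE j}      (inj₁ refl) = here refl
  endpoint-edgesAt {spokeE j}      (inj₂ refl) = here refl

  adj-edgesAtˡ : ∀ {a b} (x : Adj n p q a b) → edgeOfAdj x ∈ edgesAt a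
  adj-edgesAtˡ x with adj-joins x
  ... | inj₁ e = endpoint-edgesAt (inj₁ (cong proj₁ e))
  ... | inj₂ e = endpoint-edgesAt (inj₂ (cong proj₂ e))

  adj-edgesAtʳ : ∀ {a b} (x : Adj n p q a b) → edgeOfAdj x ∈ edgesAt b
  adj-edgesAtʳ x with adj-joins x
  ... | inj₁ e = endpoint-edgesAt (inj₂ (cong proj₂ e))
  ... | inj₂ e = endpoint-edgesAt (inj₁ (cong proj₁ e))

  tailAt headAt : Vertex n → End n
  tailAt (s , j) = (s , j) , tail
  headAt (s , j) = (s , back j (st s)) , head

  ends-at : ∀ (ε : End n) {v} → endG p q ε ≡ v → ε ≡ tailAt v ⊎ ε ≡ headAt v
  ends-at ((s , i) , tail) refl = inj₁ refl
  ends-at ((s , i) , head) refl = inj₂ (cong (λ k → (s , k) , head) (back-unique (st s) (st≤n s) refl))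

  endG-headAt : ∀ v → endG p q (headAt v) ≡ v
  endG-headAt (s , j) = cong (s ,_) (addMod-back j (st s) (st≤n s))

  three-ends : ∀ {v} (ε₁ ε₂ ε₃ : End n) → endG p q ε₁ ≡ v → endG p q ε₂ ≡ v → endG p q ε₃ ≡ v →
               ε₁ ≡ ε₂ ⊎ ε₁ ≡ ε₃ ⊎ ε₂ ≡ ε₃
  three-ends ε₁ ε₂ ε₃ e₁ e₂ e₃ with ends-at ε₁ e₁ | ends-at ε₂ e₂ | ends-at ε₃ e₃
  ... | inj₁ a | inj₁ b | _      = inj₁ (trans a (sym b))
  ... | inj₂ a | inj₂ b | _      = inj₁ (trans a (sym b))
  ... | inj₁ a | inj₂ _ | inj₁ c = inj₂ (inj₁ (trans a (sym c)))
  ... | inj₂ a | inj₁ _ | inj₂ c = inj₂ (inj₁ (trans a (sym c)))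
  ... | inj₁ _ | inj₂ b | inj₂ c = inj₂ (inj₂ (trans b (sym c)))
  ... | inj₂ _ | inj₁ b | inj₁ c = inj₂ (inj₂ (trans b (sym c)))

  localDeg : SubQ n → Vertex n → ℕ
  localDeg W v = ind (W (edgeOf (tailAt v))) + ind (W (edgeOf (headAt v)))

  localDeg≤2 : ∀ W v → localDeg W v ≤ 2
  localDeg≤2 W v = +-mono-≤ (ind≤1 (W (edgeOf (tailAt v)))) (ind≤1 (W (edgeOf (headAt v))))

  deg-split : ∀ W j → deg p q W j ≡ localDeg W (outer , j) + localDeg W (inner , j)
  deg-split W j = begin
    deg p q W j
      ≡⟨ sum-cartesianProduct g (cartesianProduct allSides (allFin n)) allPos ⟩
    sum (map (λ e → g (e , tail) + (g (e , head) + 0)) (cartesianProduct allSides (allFin n)))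
      ≡⟨ sum-cartesianProduct (λ e → g (e , tail) + (g (e , head) + 0)) allSides (allFin n) ⟩
    perSide outer + (perSide inner + 0)
      ≡⟨ cong₂ _+_ (atSide outer) (trans (+-identityʳ _) (atSide inner)) ⟩
    localDeg W (outer , j) + localDeg W (inner , j) ∎
    where
    open ≡-Reasoning
    g : End n → ℕ
    g ε = ind (W (edgeOf ε) ∧ ⌊ endQ p q ε ≟F j ⌋)
    perSide : Side → ℕ
    perSide s = sum (map (λ i → g ((s , i) , tail) + (g ((s , i) , head) + 0)) (allFin n))
    -- within one side, exactly the tail of (s , j) and the head of (s , j − step s) lie at x_j
    atSide : ∀ s → perSide s ≡ localDeg W (s , j)
    atSide s = begin
      perSide s
        ≡⟨ cong sum (map-cong (λ i → cong (g ((s , i) , tail) +_) (+-identityʳ _)) (allFin n)) ⟩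
      sum (map (λ i → g ((s , i) , tail) + g ((s , i) , head)) (allFin n))
        ≡⟨ sum-map-+ (λ i → g ((s , i) , tail)) (λ i → g ((s , i) , head)) (allFin n) ⟩
      count (λ i → W (s , i) ∧ ⌊ i ≟F j ⌋) (allFin n)
        + count (λ i → W (s , i) ∧ ⌊ addMod i (st s) ≟F j ⌋) (allFin n)
        ≡⟨ cong₂ _+_ (count-∧-at (λ i → W (s , i)) (λ i → ⌊ i ≟F j ⌋) (allFin n) (allFin⁺ n)
                        (∈-allFin j) (hits refl) (λ _ e → hit e))
                     (count-∧-at (λ i → W (s , i)) (λ i → ⌊ addMod i (st s) ≟F j ⌋) (allFin n) (allFin⁺ n)
                        (∈-allFin _) (hits (addMod-back j (st s) (st≤n s)))
                        (λ _ e → back-unique (st s) (st≤n s) (hit e))) ⟩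
      localDeg W (s , j) ∎
      where
      hits : ∀ {i} → i ≡ j → ⌊ i ≟F j ⌋ ≡ true
      hits {i} e with i ≟F j
      ... | yes _  = refl
      ... | no i≢j = ⊥-elim (i≢j e)
      hit : ∀ {i} → ⌊ i ≟F j ⌋ ≡ true → i ≡ j
      hit {i} e with i ≟F j
      ... | yes i≡j = i≡j

  opposite : Side → Side
  opposite outer = inner
  opposite inner = outer

  deg-split-at : ∀ W s j → deg p q W j ≡ localDeg W (s , j) + localDeg W (opposite s , j)
  deg-split-at W outer j = deg-split W j
  deg-split-at W inner j = trans (deg-split W j) (+-comm (localDeg W (outer , j)) (localDeg W (inner , j)))

  localDeg≡2⇒both : ∀ W v → localDeg W v ≡ 2 → InW W (tailAt v) × InW W (headAt v)
  localDeg≡2⇒both W v e with W (edgeOf (tailAt v)) | W (edgeOf (headAt v))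
  ... | true  | true  = refl , refl
  ... | true  | false with () ← e
  ... | false | true  with () ← e
  ... | false | false with () ← e

  distinct-ends-full : ∀ W {v} (ε₁ ε₂ : End n) → ε₁ ≢ ε₂ → endG p q ε₁ ≡ v → endG p q ε₂ ≡ v →
                       InW W ε₁ → InW W ε₂ → localDeg W v ≡ 2
  distinct-ends-full W ε₁ ε₂ ε₁≢ε₂ e₁ e₂ w₁ w₂ with ends-at ε₁ e₁ | ends-at ε₂ e₂
  ... | inj₁ a    | inj₁ b    = ⊥-elim (ε₁≢ε₂ (trans a (sym b)))
  ... | inj₂ a    | inj₂ b    = ⊥-elim (ε₁≢ε₂ (trans a (sym b)))
  ... | inj₁ refl | inj₂ refl rewrite w₁ | w₂ = refl
  ... | inj₂ refl | inj₁ refl rewrite w₁ | w₂ = refl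

  localDeg≢0⇒end : ∀ W v → localDeg W v ≢ 0 → ∃ λ ε → InW W ε × endG p q ε ≡ v
  localDeg≢0⇒end W v ≢0 with W (edgeOf (tailAt v)) in wt | W (edgeOf (headAt v)) in wh
  ... | true  | _     = tailAt v , wt , refl
  ... | false | true  = headAt v , wh , endG-headAt v
  ... | false | false = ⊥-elim (≢0 refl)

  traversalAdj : ∀ (t : Traversal n) → Adj n p q (endG p q (departEnd t)) (endG p q (arriveEnd t))
  traversalAdj ((outer , i) , true)  = outer⁺ i
  traversalAdj ((outer , i) , false) = outer⁻ i
  traversalAdj ((inner , i) , true)  = inner⁺ i
  traversalAdj ((inner , i) , false) = inner⁻ i

  spokeAdj : ∀ s s' j → s ≢ s' → Adj n p q (s , j) (s' , j)
  spokeAdj outer outer j s≢s' = ⊥-elim (s≢s' refl)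
  spokeAdj outer inner j _    = spoke j
  spokeAdj inner outer j _    = spoke' j
  spokeAdj inner inner j s≢s' = ⊥-elim (s≢s' refl)

  GoodTransition : SubQ n → Traversal n → Traversal n → Set
  GoodTransition W t t' =
    endQ p q (arriveEnd t) ≡ endQ p q (departEnd t') ×
    (deg p q W (endQ p q (arriveEnd t)) ≡ 4 → NonTraversing (arriveEnd t) (departEnd t'))

-- W consists of the Y-edges used by the cycle; the tour lists them in the
-- order of the cycle, i.e. the cycle with its spokes contracted.
module HamiltonianToGood (n' p q : ℕ) (0<p : 0 < p) (p<n : p < suc n') (0<q : 0 < q) (q<n : q < suc n')
         (2<n : 2 < suc n')
         (c : Fin (suc n' + suc n') → Vertex (suc n')) (c-injective : Injective _≡_ _≡_ c)
         (A : ∀ k → Adj (suc n') p q (c k) (c (next k))) where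

  open Local n' p q 0<p p<n 0<q q<n

  N = n + n

  2<N : 2 < N
  2<N = <-≤-trans 2<n (m≤m+n n n)

  1<N : 1 < N
  1<N = <-trans (s≤s (s≤s z≤n)) 2<N

  edgeAt : Fin N → IEdge n
  edgeAt k = edgeOfAdj (A k)

  -- a cycle through at least three vertices uses distinct edges at distinct steps
  edgeAt-injective : ∀ {k k'} → edgeAt k ≡ edgeAt k' → k ≡ k'
  edgeAt-injective {k} {k'} e with joins-same (adj-joins (A k)) (subst (λ g → Joins g _ _) (sym e) (adj-joins (A k')))
  ... | inj₁ (same , _)     = c-injective same
  ... | inj₂ (back₁ , back₂) = ⊥-elim (next²-fixedPointFree 2<N k'
                                 (trans (cong next (sym (c-injective back₁))) (c-injective back₂)))

  -- the cycle visits every vertex: an injective list of all 2n vertices is complete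
  visit : ∀ v → ∃ λ k → c k ≡ v
  visit v with ∈-tabulate⁻ (unique-⊆⇒complete _≟V_ (tabulate⁺ c-injective) (λ _ → ∈-allVertices _)
                  (≤-reflexive (trans (length-allVertices n) (sym (length-tabulate c)))) (∈-allVertices v))
  ... | k , v≡ck = k , sym v≡ck

  Used : IEdge n → Set
  Used g = ∃ λ k → edgeAt k ≡ g

  used? : ∀ g → Dec (Used g)
  used? g = any? (λ k → edgeAt k ≟I g)

  W : SubQ n
  W e = ⌊ used? (yEdge e) ⌋

  used-true : ∀ {g} → Used g → ⌊ used? g ⌋ ≡ true
  used-true {g} u with used? g
  ... | yes _ = refl
  ... | no ¬u = ⊥-elim (¬u u)

  true-used : ∀ {g} → ⌊ used? g ⌋ ≡ true → Used g
  true-used {g} u with used? g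
  ... | yes u' = u'

  unused-false : ∀ {g} → ¬ Used g → ⌊ used? g ⌋ ≡ false
  unused-false {g} ¬u with used? g
  ... | yes u = ⊥-elim (¬u u)
  ... | no _  = refl

  -- Degrees.  At each vertex v the cycle uses exactly two of the three edges
  -- at v, namely those of the steps leaving and entering v.

  endpoint-of-step : ∀ {k v} → IsEndpoint (edgeAt k) v → c k ≡ v ⊎ c (next k) ≡ v
  endpoint-of-step {k} end with adj-joins (A k) | end
  ... | inj₁ e | inj₁ refl = inj₁ (cong proj₁ (sym e))
  ... | inj₁ e | inj₂ refl = inj₂ (cong proj₂ (sym e))
  ... | inj₂ e | inj₁ refl = inj₂ (cong proj₁ (sym e))
  ... | inj₂ e | inj₂ refl = inj₁ (cong proj₂ (sym e))

  used-at : ∀ {g v k} → c k ≡ v → Used g → g ∈ edgesAt v → g ≡ edgeAt k ⊎ g ≡ edgeAt (prev k)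
  used-at {k = k} ck≡v (k' , refl) m with endpoint-of-step (edgesAt-endpoint m)
  ... | inj₁ e = inj₁ (cong edgeAt (c-injective (trans e (sym ck≡v))))
  ... | inj₂ e = inj₂ (cong edgeAt (prev-unique (c-injective (trans e (sym ck≡v)))))

  uses-two : ∀ v → count (λ g → ⌊ used? g ⌋) (edgesAt v) ≡ 2
  uses-two v with k , ck≡v ← visit v =
    count-two (λ g → ⌊ used? g ⌋) (edgesAt v) (edgesAt-unique v)
      (subst (λ u → edgeAt k ∈ edgesAt u) ck≡v (adj-edgesAtˡ (A k)))
      (subst (λ u → edgeAt (prev k) ∈ edgesAt u) (trans (cong c (next-prev k)) ck≡v) (adj-edgesAtʳ (A (prev k))))
      (λ e → next-fixedPointFree 1<N (prev k) (trans (next-prev k) (edgeAt-injective e)))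
      (used-true (k , refl)) (used-true (prev k , refl))
      (λ m u → used-at ck≡v (true-used u) m)

  spoke+localDeg : ∀ s j → ind ⌊ used? (spokeE j) ⌋ + localDeg W (s , j) ≡ 2
  spoke+localDeg s j =
    trans (cong (λ z → ind ⌊ used? (spokeE j) ⌋ + (ind (W (s , j)) + z)) (sym (+-identityʳ _))) (uses-two (s , j))

  localDeg-spokeUsed : ∀ {j} → Used (spokeE j) → ∀ s → localDeg W (s , j) ≡ 1
  localDeg-spokeUsed {j} u s =
    suc-injective (trans (cong (λ b → ind b + localDeg W (s , j)) (sym (used-true u))) (spoke+localDeg s j))

  localDeg-spokeUnused : ∀ {j} → ¬ Used (spokeE j) → ∀ s → localDeg W (s , j) ≡ 2
  localDeg-spokeUnused {j} ¬u s =
    trans (cong (λ b → ind b + localDeg W (s , j)) (sym (unused-false ¬u))) (spoke+localDeg s j)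

  deg-spokeUsed : ∀ {j} → Used (spokeE j) → deg p q W j ≡ 2
  deg-spokeUsed {j} u = trans (deg-split W j) (cong₂ _+_ (localDeg-spokeUsed u outer) (localDeg-spokeUsed u inner))

  deg-spokeUnused : ∀ {j} → ¬ Used (spokeE j) → deg p q W j ≡ 4
  deg-spokeUnused {j} ¬u = trans (deg-split W j) (cong₂ _+_ (localDeg-spokeUnused ¬u outer) (localDeg-spokeUnused ¬u inner))

  degrees : Degrees24 p q W
  degrees j with used? (spokeE j)
  ... | yes u = inj₁ (deg-spokeUsed u)
  ... | no ¬u = inj₂ (deg-spokeUnused ¬u)

  -- at a degree-2 vertex each side has local degree 1, so two distinct W-ends there lie on different sides
  admissible : Admissible p q W
  admissible j d2 ε₁ ε₂ w₁ w₂ e₁ e₂ ε₁≢ε₂ same with used? (spokeE j)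
  ... | no ¬u = 4≢2 (trans (sym (deg-spokeUnused ¬u)) d2)
    where
    4≢2 : 4 ≢ 2
    4≢2 ()
  ... | yes u = 1≢2 (trans (sym (localDeg-spokeUsed u (spokeSide ε₁)))
                  (distinct-ends-full W ε₁ ε₂ ε₁≢ε₂ (trans (endG-split p q ε₁) (cong (_ ,_) e₁))
                    (trans (endG-split p q ε₂) (cong₂ _,_ (sym same) e₂)) w₁ w₂))
    where
    1≢2 : 1 ≢ 2
    1≢2 ()

  -- The tour.  Steps along Y-edges are kept, spoke steps are dropped.

  IsYStep : Fin N → Set
  IsYStep k = IsY (edgeAt k)

  isYStep? : ∀ k → Dec (IsYStep k)
  isYStep? k with edgeAt k
  ... | yEdge _  = yes tt
  ... | spokeE _ = no (λ ())

  -- the traversal performed by a step (only used for steps along Y-edges)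
  traversalOf : ∀ {a b} → Adj n p q a b → Traversal n
  traversalOf (spoke i)  = (outer , i) , true
  traversalOf (spoke' i) = (outer , i) , true
  traversalOf (outer⁺ i) = (outer , i) , true
  traversalOf (outer⁻ i) = (outer , i) , false
  traversalOf (inner⁺ i) = (inner , i) , true
  traversalOf (inner⁻ i) = (inner , i) , false

  record TraversesY {a b} (x : Adj n p q a b) : Set where
    field
      departs : endG p q (departEnd (traversalOf x)) ≡ a
      arrives : endG p q (arriveEnd (traversalOf x)) ≡ b
      along   : edgeOfAdj x ≡ yEdge (proj₁ (traversalOf x))

  traversesY : ∀ {a b} (x : Adj n p q a b) → IsY (edgeOfAdj x) → TraversesY x
  traversesY (outer⁺ i) _ = record { departs = refl ; arrives = refl ; along = refl }
  traversesY (outer⁻ i) _ = record { departs = refl ; arrives = refl ; along = refl }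
  traversesY (inner⁺ i) _ = record { departs = refl ; arrives = refl ; along = refl }
  traversesY (inner⁻ i) _ = record { departs = refl ; arrives = refl ; along = refl }

  tr : Fin N → Traversal n
  tr k = traversalOf (A k)

  spoke-step : ∀ {k j} → edgeAt k ≡ spokeE j → proj₂ (c k) ≡ j × proj₂ (c (next k)) ≡ j
  spoke-step {k} e = spoke-joins (subst (λ g → Joins g _ _) e (adj-joins (A k)))

  no-two-spokes : ∀ {x y} → next x ≡ y → ¬ IsYStep x → ¬ IsYStep y → ⊥
  no-two-spokes {x} {y} nx≡y ¬yx ¬yy with notY⇒spoke (edgeAt x) ¬yx | notY⇒spoke (edgeAt y) ¬yy
  ... | j , ex | j' , ey =
    next-fixedPointFree 1<N x (trans nx≡y (sym (edgeAt-injective (trans ex (trans (cong spokeE j≡j') (sym ey))))))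
    where
    j≡j' : j ≡ j'
    j≡j' = trans (sym (proj₂ (spoke-step ex))) (trans (cong (λ k → proj₂ (c k)) nx≡y) (proj₁ (spoke-step ey)))

  early-Y-step : IsYStep fz ⊎ IsYStep (next fz)
  early-Y-step with isYStep? fz | isYStep? (next fz)
  ... | yes y₀ | _      = inj₁ y₀
  ... | no _   | yes y₁ = inj₂ y₁
  ... | no ¬y₀ | no ¬y₁ = ⊥-elim (no-two-spokes refl ¬y₀ ¬y₁)

  Next : Fin N → Fin N → Set
  Next u v = next u ≡ v

  hop-transition : ∀ {x y} → Hop Next IsYStep x y → GoodTransition W (tr x) (tr y)
  hop-transition {x} {y} (yx , yy , inj₁ nx≡y) = cong proj₂ meet , λ _ → cong proj₁ sameSide
    where
    open TraversesY
    meet : endG p q (arriveEnd (tr x)) ≡ endG p q (departEnd (tr y))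
    meet = trans (arrives (traversesY (A x) yx)) (trans (cong c nx≡y) (sym (departs (traversesY (A y) yy))))
    sameSide : (spokeSide (arriveEnd (tr x)) , _) ≡ (spokeSide (departEnd (tr y)) , _)
    sameSide = trans (sym (endG-split p q (arriveEnd (tr x)))) (trans meet (endG-split p q (departEnd (tr y))))
  hop-transition {x} {y} (yx , yy , inj₂ (z , nx≡z , ¬yz , nz≡y)) with notY⇒spoke (edgeAt z) ¬yz
  ... | j , ez = trans arrive-j (sym depart-j) ,
                 λ d4 → ⊥-elim (4≢2 (trans (sym d4) (trans (cong (deg p q W) arrive-j) (deg-spokeUsed (z , ez)))))
    where
    open TraversesY
    4≢2 : 4 ≢ 2
    4≢2 ()
    arrive-j : endQ p q (arriveEnd (tr x)) ≡ j
    arrive-j = trans (cong proj₂ (arrives (traversesY (A x) yx)))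
                 (trans (cong (λ k → proj₂ (c k)) nx≡z) (proj₁ (spoke-step ez)))
    depart-j : endQ p q (departEnd (tr y)) ≡ j
    depart-j = trans (cong proj₂ (departs (traversesY (A y) yy)))
                 (trans (cong (λ k → proj₂ (c k)) (sym nz≡y)) (proj₂ (spoke-step ez)))

  module Tour (y₀ : IsYStep fz) where
    open TraversesY

    Ys : List (Fin N)
    Ys = filter isYStep? (tabulate fs)

    Ix : List (Fin N)
    Ix = fz ∷ Ys

    Ix-IsY : ∀ {k} → k ∈ Ix → IsYStep k
    Ix-IsY (here refl) = y₀
    Ix-IsY (there m)   = proj₂ (∈-filter⁻ isYStep? {xs = tabulate fs} m)

    Ix-complete : ∀ {k} → IsYStep k → k ∈ Ix
    Ix-complete {fz}   _ = here refl
    Ix-complete {fs k} y = there (∈-filter⁺ isYStep? (∈-tabulate⁺ k) y)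

    Ix-unique : Unique Ix
    Ix-unique = All.tabulate 0∉Ys ∷ filter⁺ isYStep? (tabulate⁺ fs-injective)
      where
      fs-injective : ∀ {M} {i j : Fin M} → fs i ≡ fs j → i ≡ j
      fs-injective refl = refl
      0∉Ys : ∀ {x} → x ∈ Ys → fz ≢ x
      0∉Ys m 0≡x with i , x≡fs ← ∈-tabulate⁻ (proj₁ (∈-filter⁻ isYStep? {xs = tabulate fs} m))
        with () ← trans 0≡x x≡fs

    T : List (Traversal n)
    T = map tr Ix

    Ix-along : ∀ {k} → k ∈ Ix → edgeAt k ≡ yEdge (proj₁ (tr k))
    Ix-along {k} m = along (traversesY (A k) (Ix-IsY m))

    Ix-same-edge : ∀ {k k'} → k ∈ Ix → k' ∈ Ix → proj₁ (tr k) ≡ proj₁ (tr k') → k ≡ k'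
    Ix-same-edge m m' e = edgeAt-injective (trans (Ix-along m) (trans (cong yEdge e) (sym (Ix-along m'))))

    T-edge-injective : ∀ {t t'} → t ∈ T → t' ∈ T → proj₁ t ≡ proj₁ t' → t ≡ t'
    T-edge-injective m m' e with k , mk , refl ← ∈-map⁻ tr m | k' , mk' , refl ← ∈-map⁻ tr m' =
      cong tr (Ix-same-edge mk mk' e)

    T-unique : Unique T
    T-unique = unique-map-injectiveOn tr Ix-unique (λ m m' e → Ix-same-edge m m' (cong proj₁ e))

    T-closed : Chain (GoodTransition W) (tr fz) (map tr Ys) (tr fz)
    T-closed = chain-map tr hop-transition
                 (chain-filter isYStep? no-two-spokes (tabulate fs) y₀ y₀ (closedChain (λ k → k) (λ k → refl)))

    T-in-W : ∀ {t} → t ∈ T → W (proj₁ t) ≡ true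
    T-in-W m with k , mk , refl ← ∈-map⁻ tr m = used-true (k , Ix-along mk)

    T-covers : ∀ e → W e ≡ true → ∃ λ t → t ∈ T × proj₁ t ≡ e
    T-covers e w with k , ek ← true-used w =
      tr k , ∈-map⁺ tr (Ix-complete y) , yEdge-injective (trans (sym (along (traversesY (A k) y))) ek)
      where
      y : IsYStep k
      y = subst IsY (sym ek) tt

    tour : GoodEulerianTour p q W
    tour = length T , lookup T
         , (λ {i} {j} e → lookup-injective T T-unique (T-edge-injective (∈-lookup i) (∈-lookup j) e))
         , (λ k → T-in-W (∈-lookup k))
         , covers
         , (λ k → proj₁ (cyclicLookup T-closed k))
         , (λ k → proj₂ (cyclicLookup T-closed k))
      where
      covers : ∀ e → W e ≡ true → ∃ λ k → proj₁ (lookup T k) ≡ e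
      covers e w with t , m , te ← T-covers e w = Any.index m , trans (cong proj₁ (sym (lookup-index m))) te

    good : GoodEulerianSubgraph p q W
    good = degrees , admissible , tour

-- Following the tour, each traversal of a Q-edge becomes the corresponding
-- move of I; between two traversals the cycle crosses the spoke of x_j
-- exactly when the transition at x_j is traversing.
module GoodToHamiltonian (n' p q : ℕ) (0<p : 0 < p) (p<n : p < suc n') (0<q : 0 < q) (q<n : q < suc n')
         (W : SubQ (suc n')) (degrees : Degrees24 p q W) (admissible : Admissible p q W) where

  open Local n' p q 0<p p<n 0<q q<n

  -- every vertex of I carries a W-end: otherwise all W-ends at x_j would lie on
  -- the other side of its spoke, forcing degree 2 with a non-traversing pair
  end-at-vertex : ∀ v → ∃ λ ε → InW W ε × endG p q ε ≡ v
  end-at-vertex (s , j) = localDeg≢0⇒end W (s , j) nonzero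
    where
    v' = (opposite s , j)
    nonzero : localDeg W (s , j) ≢ 0
    nonzero empty with degrees j
    ... | inj₂ d4 = 4≰2 (subst (_≤ 2) v'-has-4 (localDeg≤2 W v'))
      where
      v'-has-4 : localDeg W v' ≡ 4
      v'-has-4 = trans (cong (_+ localDeg W v') (sym empty)) (trans (sym (deg-split-at W s j)) d4)
      4≰2 : ¬ (4 ≤ 2)
      4≰2 (s≤s (s≤s ()))
    ... | inj₁ d2 = admissible j d2 (tailAt v') (headAt v') tw hw refl (cong proj₂ (endG-headAt v')) (λ ()) refl
      where
      both = localDeg≡2⇒both W v' (trans (sym (trans (deg-split-at W s j) (cong (_+ localDeg W v') empty))) d2)
      tw = proj₁ both
      hw = proj₂ both

  Switches : Traversal n → Traversal n → Set
  Switches t t' = Traversing (arriveEnd t) (departEnd t')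

  -- between leaving along t and leaving along t', the walk in I also visits the
  -- arrival end of t when it has to cross the spoke
  extra : Traversal n → Traversal n → List (End n)
  extra t t' with spokeSide (arriveEnd t) ≟S spokeSide (departEnd t')
  ... | yes _ = []
  ... | no _  = [ arriveEnd t ]

  extra-∈ : ∀ t t' {ε} → ε ∈ extra t t' → ε ≡ arriveEnd t × Switches t t'
  extra-∈ t t' m with spokeSide (arriveEnd t) ≟S spokeSide (departEnd t') | m
  ... | no sw | here e = e , sw

  ∈-extra : ∀ t t' → Switches t t' → arriveEnd t ∈ extra t t'
  ∈-extra t t' sw with spokeSide (arriveEnd t) ≟S spokeSide (departEnd t')
  ... | yes same = ⊥-elim (sw same)
  ... | no _     = here refl

  MovesI : End n → End n → Set
  MovesI ε ε' = Adj n p q (endG p q ε) (endG p q ε')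

  extra-chain : ∀ t t' → endQ p q (arriveEnd t) ≡ endQ p q (departEnd t') →
                Chain MovesI (departEnd t) (extra t t') (departEnd t')
  extra-chain t t' meet with spokeSide (arriveEnd t) ≟S spokeSide (departEnd t')
  ... | yes same = done (subst (Adj n p q (endG p q (departEnd t))) arrive≡depart (traversalAdj t))
    where
    arrive≡depart : endG p q (arriveEnd t) ≡ endG p q (departEnd t')
    arrive≡depart = trans (endG-split p q (arriveEnd t)) (trans (cong₂ _,_ same meet) (sym (endG-split p q (departEnd t'))))
  ... | no sw = link (traversalAdj t) (done (subst₂ (Adj n p q) (sym (endG-split p q (arriveEnd t)))
                                                  (sym (endG-split p q (departEnd t')))
                 (subst (λ j → Adj n p q (_ , endQ p q (arriveEnd t)) (_ , j)) meet (spokeAdj _ _ _ sw))))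

  rest : Traversal n → List (Traversal n) → Traversal n → List (End n)
  rest a []       b = extra a b
  rest a (x ∷ xs) b = extra a x ++ departEnd x ∷ rest x xs b

  expand : Traversal n → List (Traversal n) → Traversal n → List (End n)
  expand a xs b = departEnd a ∷ rest a xs b

  expand-chain : ∀ {a xs b} → Chain (GoodTransition W) a xs b → Chain MovesI (departEnd a) (rest a xs b) (departEnd b)
  expand-chain {a} {[]}     {b} (done g)   = extra-chain a b (proj₁ g)
  expand-chain {a} {x ∷ xs} {b} (link g c) = chain-++ (extra a x) (rest x xs b) (extra-chain a x (proj₁ g)) (expand-chain c)

  Listed : Traversal n → List (Traversal n) → Traversal n → End n → Set
  Listed a xs b ε = ∃₂ λ t t' → Consec a xs b t t' × (ε ≡ departEnd t ⊎ (ε ≡ arriveEnd t × Switches t t'))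

  expand-listed : ∀ a xs b {ε} → ε ∈ expand a xs b → Listed a xs b ε
  expand-listed a []       b (here e)  = a , b , last , inj₁ e
  expand-listed a []       b (there m) = a , b , last , inj₂ (extra-∈ a b m)
  expand-listed a (x ∷ xs) b (here e)  = a , x , first , inj₁ e
  expand-listed a (x ∷ xs) b (there m) with ∈-++⁻ (extra a x) m
  ... | inj₁ m' = a , x , first , inj₂ (extra-∈ a x m')
  ... | inj₂ m' with t , t' , k , r ← expand-listed x xs b m' = t , t' , later k , r

  departEnd-∈-expand : ∀ {a xs b t t'} → Consec a xs b t t' → departEnd t ∈ expand a xs b
  departEnd-∈-expand last  = here refl
  departEnd-∈-expand first = here refl
  departEnd-∈-expand {a} {x ∷ xs} (later k) = there (∈-++⁺ʳ (extra a x) (departEnd-∈-expand k))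

  arriveEnd-∈-expand : ∀ {a xs b t t'} → Consec a xs b t t' → Switches t t' → arriveEnd t ∈ expand a xs b
  arriveEnd-∈-expand {a} {[]}     {b} last  sw = there (∈-extra a b sw)
  arriveEnd-∈-expand {a} {x ∷ xs} {b} first sw = there (∈-++⁺ˡ (∈-extra a x sw))
  arriveEnd-∈-expand {a} {x ∷ xs}     (later k) sw = there (∈-++⁺ʳ (extra a x) (arriveEnd-∈-expand k sw))

  expand-edge : ∀ a xs b {ε} → ε ∈ expand a xs b → edgeOf ε ∈ map proj₁ (a ∷ xs)
  expand-edge a xs b m with t , t' , k , r ← expand-listed a xs b m =
    subst (_∈ map proj₁ (a ∷ xs)) (sym (edge {t' = t'} r)) (∈-map⁺ proj₁ (consec-fst k))
    where
    edge : ∀ {ε t t'} → ε ≡ departEnd t ⊎ (ε ≡ arriveEnd t × Switches t t') → edgeOf ε ≡ proj₁ t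
    edge {t = t} (inj₁ e)       = trans (cong edgeOf e) (departEnd-edge t)
    edge {t = t} (inj₂ (e , _)) = trans (cong edgeOf e) (arriveEnd-edge t)

  expand-unique : ∀ a xs b → Unique (map proj₁ (a ∷ xs)) → Unique (expand a xs b)
  expand-unique a []       b u = block-unique a b
    where
    block-unique : ∀ t t' → Unique (departEnd t ∷ extra t t')
    block-unique t t' with spokeSide (arriveEnd t) ≟S spokeSide (departEnd t')
    ... | yes _ = All.[] ∷ []
    ... | no _  = ((λ e → arriveEnd≢departEnd t (sym e)) All.∷ All.[]) ∷ (All.[] ∷ [])
  expand-unique a (x ∷ xs) b (a∉ ∷ u) = ++⁺ (expand-unique a [] x (All.[] ∷ [])) (expand-unique x xs b u) disjoint
    where
    disjoint : ∀ {ε} → ¬ (ε ∈ expand a [] x × ε ∈ expand x xs b)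
    disjoint (m , m') =
      All.lookup a∉ (subst (_∈ map proj₁ (x ∷ xs)) (here⇒a (expand-edge a [] x m)) (expand-edge x xs b m')) refl
      where
      here⇒a : ∀ {e} → e ∈ map proj₁ (a ∷ []) → e ≡ proj₁ a
      here⇒a (here e) = e

  module FromTour (m' : ℕ) (w : Fin (suc m') → Traversal n)
                  (w-injective : Injective _≡_ _≡_ (λ k → proj₁ (w k)))
                  (w-in-W : ∀ k → W (proj₁ (w k)) ≡ true)
                  (w-covers : ∀ e → W e ≡ true → ∃ λ k → proj₁ (w k) ≡ e)
                  (w-good : ∀ k → GoodTransition W (w k) (w (next k))) where

    a : Traversal n
    a = w fz

    xs : List (Traversal n)
    xs = tabulate (λ k → w (fs k))

    T-closed : Chain (GoodTransition W) a xs a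
    T-closed = closedChain w w-good

    T-in-W : ∀ {t} → t ∈ a ∷ xs → W (proj₁ t) ≡ true
    T-in-W m with k , refl ← ∈-tabulate⁻ {f = w} m = w-in-W k

    T-edge-injective : ∀ {t t'} → t ∈ a ∷ xs → t' ∈ a ∷ xs → proj₁ t ≡ proj₁ t' → t ≡ t'
    T-edge-injective m m' e with k , refl ← ∈-tabulate⁻ {f = w} m | k' , refl ← ∈-tabulate⁻ {f = w} m' =
      cong w (w-injective e)

    Ends : List (End n)
    Ends = expand a xs a

    Ends-in-W : ∀ {ε} → ε ∈ Ends → InW W ε
    Ends-in-W m with t , mt , e ← ∈-map⁻ proj₁ (expand-edge a xs a m) = subst (λ z → W z ≡ true) (sym e) (T-in-W mt)

    -- at a degree-4 vertex the transitions do not switch, so only departure ends are listed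
    listed-at-deg4 : ∀ {ε} → ε ∈ Ends → deg p q W (endQ p q ε) ≡ 4 →
                     ∃₂ λ t t' → Consec a xs a t t' × ε ≡ departEnd t
    listed-at-deg4 m d4 with expand-listed a xs a m
    ... | t , t' , k , inj₁ e        = t , t' , k , e
    ... | t , t' , k , inj₂ (e , sw) =
      ⊥-elim (sw (proj₂ (chain-consec T-closed k) (subst (λ ε → deg p q W (endQ p q ε) ≡ 4) e d4)))

    arrive≢depart : ∀ {u t} → u ∈ a ∷ xs → t ∈ a ∷ xs → arriveEnd u ≢ departEnd t
    arrive≢depart {u} {t} mu mt ad = arriveEnd≢departEnd t (trans (cong arriveEnd (sym u≡t)) ad)
      where
      u≡t = T-edge-injective mu mt (trans (sym (arriveEnd-edge u)) (trans (cong edgeOf ad) (departEnd-edge t)))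

    predecessor-arrives : ∀ {t t'} → Consec a xs a t t' → deg p q W (endQ p q (departEnd t)) ≡ 4 →
                          ∃ λ u → u ∈ a ∷ xs × endG p q (arriveEnd u) ≡ endG p q (departEnd t)
    predecessor-arrives k d4 with u , kᵤ ← cyclic-pred {a = a} {xs = xs} (consec-fst k) =
      u , consec-fst kᵤ ,
      trans (endG-split p q (arriveEnd u)) (trans (cong₂ _,_ (nonTrav (subst (λ j → deg p q W j ≡ 4) (sym meet) d4)) meet)
        (sym (endG-split p q _)))
      where
      meet = proj₁ (chain-consec T-closed kᵤ)
      nonTrav = proj₂ (chain-consec T-closed kᵤ)

    Ends-injective : ∀ {ε₁ ε₂} → ε₁ ∈ Ends → ε₂ ∈ Ends → endG p q ε₁ ≡ endG p q ε₂ → ε₁ ≡ ε₂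
    Ends-injective {ε₁} {ε₂} m₁ m₂ e with ε₁ ≟E ε₂ | endG-≡ p q e
    ... | yes same | _ = same
    ... | no ε₁≢ε₂ | sameSide , sameQ with degrees (endQ p q ε₁)
    ...   | inj₁ d2 = ⊥-elim (admissible _ d2 ε₁ ε₂ (Ends-in-W m₁) (Ends-in-W m₂) refl (sym sameQ) ε₁≢ε₂ sameSide)
    ...   | inj₂ d4
      with t₁ , _ , k₁ , refl ← listed-at-deg4 m₁ d4
         | t₂ , _ , k₂ , refl ← listed-at-deg4 m₂ (subst (λ j → deg p q W j ≡ 4) sameQ d4)
      with u , mu , uAt ← predecessor-arrives k₁ d4
      with three-ends (arriveEnd u) ε₁ ε₂ uAt refl (sym e)
    ... | inj₁ u≡₁        = ⊥-elim (arrive≢depart mu (consec-fst k₁) u≡₁)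
    ... | inj₂ (inj₁ u≡₂) = ⊥-elim (arrive≢depart mu (consec-fst k₂) u≡₂)
    ... | inj₂ (inj₂ 1≡2) = ⊥-elim (ε₁≢ε₂ 1≡2)

    Vs : List (Vertex n)
    Vs = map (endG p q) Ends

    Vs-unique : Unique Vs
    Vs-unique = unique-map-injectiveOn (endG p q) (expand-unique a xs a (unique-map-injectiveOn proj₁
                  (tabulate⁺ {f = w} (λ e → w-injective (cong proj₁ e))) T-edge-injective)) Ends-injective

    Vs-complete : ∀ v → v ∈ Vs
    Vs-complete v with ε , wε , εAt ← end-at-vertex v with k , ek ← w-covers (edgeOf ε) wε
      with t' , kk ← consec-succ {a = a} {xs = xs} {b = a} (∈-tabulate⁺ {f = w} k)
      with ends-of-traversal (w k) ε ek
    ... | inj₁ dep = subst (_∈ Vs) (trans (cong (endG p q) (sym dep)) εAt) (∈-map⁺ (endG p q) (departEnd-∈-expand kk))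
    ... | inj₂ arr with spokeSide (arriveEnd (w k)) ≟S spokeSide (departEnd t')
    ...   | no sw = subst (_∈ Vs) (trans (cong (endG p q) (sym arr)) εAt) (∈-map⁺ (endG p q) (arriveEnd-∈-expand kk sw))
    ...   | yes same with t'' , kk' ← consec-succ {a = a} {xs = xs} {b = a} (∈-∷ʳ⇒∈-∷ xs (consec-snd kk)) =
      subst (_∈ Vs) departs-at (∈-map⁺ (endG p q) (departEnd-∈-expand kk'))
      where
      -- without a switch the next traversal leaves from the vertex where w k arrives
      departs-at : endG p q (departEnd t') ≡ v
      departs-at = trans (endG-split p q (departEnd t'))
                     (trans (sym (cong₂ _,_ same (proj₁ (chain-consec T-closed kk))))
                       (trans (sym (endG-split p q (arriveEnd (w k)))) (trans (cong (endG p q) (sym arr)) εAt)))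

    Vs-length : length Vs ≡ n + n
    Vs-length = ≤-antisym
      (subst (length Vs ≤_) (length-allVertices n) (unique-⊆⇒length≤ Vs-unique (λ _ → ∈-allVertices _)))
      (subst (_≤ length Vs) (length-allVertices n) (unique-⊆⇒length≤ (allVertices-unique n) (λ _ → Vs-complete _)))

    hamiltonian : Hamiltonian n p q
    hamiltonian = cycleOf Vs-length
      where
      cycleOf : ∀ {L} → length Vs ≡ L →
                Σ (Fin L → Vertex n) λ c → Injective _≡_ _≡_ c × (∀ k → Adj n p q (c k) (c (next k)))
      cycleOf refl = lookup Vs , lookup-injective Vs Vs-unique ,
                     cyclicLookup (chain-map {R = MovesI} {S = Adj n p q} (endG p q) (λ x → x) (expand-chain T-closed))

  goodTour⇒hamiltonian : GoodEulerianTour p q W → Hamiltonian n p q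
  goodTour⇒hamiltonian (zero , w , _ , _ , covers , _) with ε , wε , _ ← end-at-vertex (outer , fz)
    with () , _ ← covers (edgeOf ε) wε
  goodTour⇒hamiltonian (suc m' , w , w-injective , w-in-W , w-covers , meet , nonTrav) =
    FromTour.hamiltonian m' w w-injective w-in-W w-covers (λ k → meet k , nonTrav k)

-- A Hamiltonian cycle, started at its first or second step (one of which
-- runs along a Y-edge), yields a good Eulerian subgraph.
hamiltonian⇒good : ∀ n' p q → 0 < p → p < suc n' → 0 < q → q < suc n' → 2 < suc n' →
                   Hamiltonian (suc n') p q → ∃ λ (W : SubQ (suc n')) → GoodEulerianSubgraph p q W
hamiltonian⇒good n' p q 0<p p<n 0<q q<n 2<n (c , c-injective , A) =
  [ (λ y₀ → H.W , H.Tour.good y₀) , (λ y₁ → H′.W , H′.Tour.good y₁) ]′ H.early-Y-step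
  where
  module H  = HamiltonianToGood n' p q 0<p p<n 0<q q<n 2<n c c-injective A
  module H′ = HamiltonianToGood n' p q 0<p p<n 0<q q<n 2<n (λ k → c (next k))
                (λ e → next-injective (c-injective e)) (λ k → A (next k))

corollary6 : ∀ (n p q : ℕ) → 3 ≤ n → 1 ≤ p → p < n → 1 ≤ q → q < n →
    p + p ≢ n → q + q ≢ n → Connected n p q →
    (Hamiltonian n p q ⇔ ∃ λ (W : SubQ n) → GoodEulerianSubgraph p q W)
corollary6 zero     p q ()
corollary6 (suc n') p q 3≤n 0<p p<n 0<q q<n _ _ _ =
  mk⇔ (hamiltonian⇒good n' p q 0<p p<n 0<q q<n 3≤n)
      (λ (W , degrees , admissible , tour) →
         GoodToHamiltonian.goodTour⇒hamiltonian n' p q 0<p p<n 0<q q<n W degrees admissible tour)
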